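{- Let $m>0$, let $(X,R)$ be a frame with $R^{m+1}\subseteq R\cup Id_X$, and let $C$ be an $m$-regular cluster in it. Then $R^{nm+1}(a)\subseteq R(a)$ for all $a\in C$ and all $n<\omega$.
   Context: $R(a)=\{b: aRb\}$; $R^0=Id_X$, $R^{i+1}=R\circ R^i$, $R^*=\bigcup_{i<\omega}R^i$. A cluster is an equivalence class of $a\sim b$ iff $aR^*b$ and $bR^*a$. A cluster $C$ is $m$-regular if $S=R\cap(C\times C)$ satisfies $S^{m+1}\subseteq S$. -}

module Defs where

open import Data.Nat using (ℕ; zero; suc; _+_; _*_)
open import Data.Product using (Σ; ∃; _×_; _,_)
open import Data.Sum using (_⊎_)
open import Relation.Binary.PropositionalEquality using (_≡_)
open import Function.Bundles using (_⇔_)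

Rel : Set → Set₁
Rel X = X → X → Set

pow : {X : Set} → Rel X → ℕ → Rel X
pow R zero    a b = a ≡ b
pow R (suc i) a b = ∃ λ c → pow R i a c × R c b

star : {X : Set} → Rel X → Rel X
star R a b = ∃ λ i → pow R i a b

_∼⟨_⟩_ : {X : Set} → X → Rel X → X → Set
a ∼⟨ R ⟩ b = star R a b × star R b a

IsCluster : {X : Set} → Rel X → (X → Set) → Set
IsCluster {X} R C = Σ X λ a → C a × (∀ b → C b ⇔ (a ∼⟨ R ⟩ b))

restrict : {X : Set} → Rel X → (X → Set) → Rel X
restrict R C a b = R a b × C a × C b

_⊆ᴿ_ : {X : Set} → Rel X → Rel X → Set
R ⊆ᴿ Q = ∀ a b → R a b → Q a b

_∪Id : {X : Set} → Rel X → Rel X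
(R ∪Id) a b = R a b ⊎ a ≡ b

Regular : {X : Set} → Rel X → ℕ → (X → Set) → Set
Regular R m C = pow (restrict R C) (suc m) ⊆ᴿ restrict R C

{-# OPTIONS --safe #-}
-- Induction on n: an R^{(n+1)m+1}-path from a splits as an R^{nm+1}-path to some c
-- followed by an R^m-path to b, so by induction a R c and hence a R^{m+1} b, which
-- gives a R b or a = b. In the second case a R c R^m a is a cycle through a; every
-- point of a cycle lies in the cluster of a, so the cycle is an S^{m+1}-path and
-- m-regularity yields a S a, in particular a R a.
module Submission where

open import Defs
open import Data.Nat using (ℕ; zero; suc; _*_; _+_; _>_)
open import Data.Nat.Properties using (+-assoc)
open import Data.Product using (∃; _×_; _,_; proj₁; proj₂)
open import Data.Sum using (inj₁; inj₂)
open import Relation.Binary.PropositionalEquality using (refl; subst)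
open import Function.Bundles using (Equivalence)

module _ {X : Set} (T : Rel X) where

  pow-++ : ∀ i j {a b c} → pow T i a b → pow T j b c → pow T (j + i) a c
  pow-++ i zero    p refl        = p
  pow-++ i (suc j) p (d , q , t) = d , pow-++ i j p q , t

  pow-split : ∀ i j {a c} → pow T (j + i) a c → ∃ λ b → pow T i a b × pow T j b c
  pow-split i zero    p = _ , p , refl
  pow-split i (suc j) (d , q , t) with pow-split i j q
  ... | b , p , p′ = b , p , (d , p′ , t)

  pow-cons : ∀ m {a c b} → T a c → pow T m c b → pow T (suc m) a b
  pow-cons zero    t refl        = _ , refl , t
  pow-cons (suc m) t (d , q , u) = d , pow-cons m t q , u

  star-trans : ∀ {a b c} → star T a b → star T b c → star T a c
  star-trans (i , p) (j , q) = j + i , pow-++ i j p q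

  pow-absorbʳ : ∀ m {a} → (∀ {c b} → T a c → pow T m c b → T a b) →
                ∀ n {b} → pow T (n * m + 1) a b → T a b
  pow-absorbʳ m absorb zero    (_ , refl , t) = t
  pow-absorbʳ m {a} absorb (suc n) {b} p
    with pow-split (n * m + 1) m (subst (λ k → pow T k a b) (+-assoc m (n * m) 1) p)
  ... | c , p₁ , p₂ = absorb (pow-absorbʳ m absorb n p₁) p₂

module _ {X : Set} (R : Rel X) (C : X → Set) (cluster : IsCluster R C) where

  cluster-closed : ∀ {a b} → C a → star R a b → star R b a → C b
  cluster-closed {a} {b} ca a⇝b b⇝a =
    Equivalence.from (proj₂ (proj₂ cluster) b)
      (star-trans R (proj₁ a₀∼a) a⇝b , star-trans R b⇝a (proj₂ a₀∼a))
    where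
    a₀∼a : proj₁ cluster ∼⟨ R ⟩ a
    a₀∼a = Equivalence.to (proj₂ (proj₂ cluster) a) ca

  pow-restrict-cycle : ∀ k {a x} → C a → pow R k a x → star R x a → pow (restrict R C) k a x
  pow-restrict-cycle zero    ca refl        _  = refl
  pow-restrict-cycle (suc k) {a} ca (c , p , t) x⇝a =
    c , pow-restrict-cycle k ca p c⇝a , t , cluster-closed ca (k , p) c⇝a
                                          , cluster-closed ca (suc k , c , p , t) x⇝a
    where
    c⇝a : star R c a
    c⇝a = star-trans R (1 , _ , refl , t) x⇝a

  regular-cluster-absorbʳ : ∀ m → pow R (suc m) ⊆ᴿ (R ∪Id) → Regular R m C →
                            ∀ {a c b} → C a → R a c → pow R m c b → R a b
  regular-cluster-absorbʳ m short regular {a} {b = b} ca t q with short a b (pow-cons R m t q)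
  ... | inj₁ r    = r
  ... | inj₂ refl =
    proj₁ (regular a a (pow-restrict-cycle (suc m) ca (pow-cons R m t q) (0 , refl)))

proposition10 : {X : Set} (R : Rel X) (m : ℕ) → m > 0 →
                pow R (suc m) ⊆ᴿ (R ∪Id) →
                (C : X → Set) → IsCluster R C → Regular R m C →
                ∀ a → C a → ∀ (n : ℕ) (b : X) → pow R (n * m + 1) a b → R a b
proposition10 R m _ short C cluster regular a ca n b =
  pow-absorbʳ R m (regular-cluster-absorbʳ R C cluster m short regular ca) n
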